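{- Let $q$ be a prime power and $n\geq 3$. Every $\mathscr{F}_3$-type family in $AG(n,\mathbb{F}_q)$ has exactly $(q^2+q+1){n-2\brack 1}-q^2-q$ elements.
   Context: Gaussian binomial coefficient: ${m\brack 1}=\frac{q^m-1}{q-1}$. The $k$-flats of $AG(n,\mathbb{F}_q)$ are the cosets $P+x$ of $k$-dimensional subspaces $P$ of $\mathbb{F}_q^n$; $\mathscr{M}(k,n)$ is the set of all $k$-flats. $\mathscr{F}_3$-type family: let $U=U'+x$ be a $3$-flat with $U'$ a $3$-dimensional subspace of $\mathbb{F}_q^n$, let $S_1,\dots,S_{q^2+q+1}$ be all $2$-dimensional subspaces of $U'$, and let $s_1,\dots,s_{q^2+q+1}\in U$. The family $\bigcup_{i}\{F\in\mathscr{M}(3,n):S_i+s_i\subseteq F\}$ is called an $\mathscr{F}_3$-type family. -}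

module Defs where

open import Level using (0ℓ)
open import Data.Nat using (ℕ; zero; suc; _^_) renaming (_+_ to _+ℕ_)
open import Data.Fin using (Fin; zero; suc)
open import Data.Product using (Σ; ∃; _×_; _,_)
open import Relation.Binary.PropositionalEquality using (_≡_)
open import Relation.Nullary using (¬_)
open import Algebra.Bundles using (CommutativeRing)

-- Gaussian binomial [m ≍ 1]_q = (q^m - 1)/(q - 1) = 1 + q + ... + q^(m-1)
gauss1 : ℕ → ℕ → ℕ
gauss1 q zero = 0
gauss1 q (suc m) = q ^ m +ℕ gauss1 q m

module Geometry (R : CommutativeRing 0ℓ 0ℓ) where
  open CommutativeRing R using (_≈_; _+_; _*_; 0#; 1#) renaming (Carrier to K)

  IsField : Set
  IsField = (¬ (1# ≈ 0#)) × (∀ a → ¬ (a ≈ 0#) → ∃ λ b → a * b ≈ 1#)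

  HasCard : ℕ → Set
  HasCard q = Σ (Fin q → K) λ e →
    (∀ i j → e i ≈ e j → i ≡ j) × (∀ a → ∃ λ i → e i ≈ a)

  Point : ℕ → Set
  Point n = Fin n → K

  _≋_ : ∀ {n} → Point n → Point n → Set
  u ≋ v = ∀ j → u j ≈ v j

  0v : ∀ {n} → Point n
  0v j = 0#

  _⊕_ : ∀ {n} → Point n → Point n → Point n
  (u ⊕ v) j = u j + v j

  sumK : ∀ {k} → (Fin k → K) → K
  sumK {zero} f = 0#
  sumK {suc k} f = f zero + sumK (λ i → f (suc i))

  lincomb : ∀ {k n} → (Fin k → K) → (Fin k → Point n) → Point n
  lincomb c b j = sumK (λ i → c i * b i j)

  Independent : ∀ {k n} → (Fin k → Point n) → Set
  Independent b = ∀ c → lincomb c b ≋ 0v → ∀ i → c i ≈ 0#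

  PSet : ℕ → Set₁
  PSet n = Point n → Set

  _⊆_ : ∀ {n} → PSet n → PSet n → Set
  A ⊆ B = ∀ v → A v → B v

  _≐_ : ∀ {n} → PSet n → PSet n → Set
  A ≐ B = (A ⊆ B) × (B ⊆ A)

  Span : ∀ {k n} → (Fin k → Point n) → PSet n
  Span b v = ∃ λ c → v ≋ lincomb c b

  IsSubspace : ∀ {n} → ℕ → PSet n → Set
  IsSubspace k P = ∃ λ (b : Fin k → Point _) → Independent b × (P ≐ Span b)

  _+ₛ_ : ∀ {n} → PSet n → Point n → PSet n
  (P +ₛ x) v = ∃ λ w → P w × (v ≋ (w ⊕ x))

  IsFlat : ∀ {n} → ℕ → PSet n → Set₁
  IsFlat k A = ∃ λ P → ∃ λ x → IsSubspace k P × (A ≐ (P +ₛ x))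

  FlatFamilySize : ∀ {n} → ℕ → (PSet n → Set₁) → ℕ → Set₁
  FlatFamilySize {n} k Fam N = Σ (Fin N → PSet n) λ L →
      (∀ j → IsFlat k (L j) × Fam (L j))
    × (∀ j j′ → L j ≐ L j′ → j ≡ j′)
    × (∀ A → IsFlat k A → Fam A → ∃ λ j → A ≐ L j)

  F3Family : ∀ {n m} → (Fin m → PSet n) → (Fin m → Point n) → PSet n → Set₁
  F3Family S s A = IsFlat 3 A × (∃ λ i → (S i +ₛ s i) ⊆ A)

-- A 3-flat through some S i + s i is either U = U′ + x or meets U exactly in S i + s i. Extend a basis
-- u of U′ by e = n − 3 vectors w to a basis of K^n, and pick r i ∈ u outside S i. The 3-spaces
-- P ⊇ S i other than U′ are then exactly the spans of S i and a r i + σ ℓ, where a ∈ K and ℓ runs over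
-- representatives of the gauss1 q e lines of K^n / U′ ≅ K^e (σ lifts along w), and all of them are
-- distinct. Two distinct planes S i, S j together span U′, so different i give different flats. The
-- family therefore has 1 + (q² + q + 1) q [e]_q members, and [e + 1]_q = 1 + q [e]_q turns this into
-- (q² + q + 1) [n − 2]_q − q² − q.
module Submission where

open import Defs
open import Level using (0ℓ)
open import Data.Nat as ℕ using (ℕ; zero; suc)
import Data.Nat.Properties as ℕ
open import Data.Fin as Fin using (Fin; zero; suc; punchIn; _↑ˡ_; _↑ʳ_)
import Data.Fin.Properties as Fin
open import Data.Product using (Σ; ∃; _×_; _,_; proj₁; proj₂)
open import Data.Sum using (_⊎_; inj₁; inj₂)
open import Data.Empty using (⊥; ⊥-elim)
open import Function using (_∘_; _↔_; Inverse)
open import Function.Properties.Inverse using (↔-refl) renaming (↔-trans to _⟨↔⟩_)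
open import Data.Sum.Function.Propositional using (_⊎-↔_)
open import Data.Product.Function.NonDependent.Propositional using (_×-↔_)
open import Data.Unit using (⊤; tt)
open import Data.Vec.Functional using (_++_; _∷_)
open import Data.Vec.Functional.Properties using (lookup-++ˡ; lookup-++ʳ)
open import Relation.Nullary using (¬_; Dec; yes; no)
open import Relation.Binary using (tri<; tri≈; tri>)
import Relation.Binary.PropositionalEquality as ≡
open ≡ using (_≡_; _≢_)
open import Algebra.Bundles using (CommutativeRing)
import Algebra.Properties.Ring as RingProperties
import Algebra.Properties.Group as GroupProperties
import Algebra.Properties.AbelianGroup as AbelianGroupProperties
import Algebra.Properties.CommutativeSemigroup as CommutativeSemigroupProperties

module LinearAlgebra (R : CommutativeRing 0ℓ 0ℓ) where
  open Geometry R
  open CommutativeRing R hiding (zero) renaming (Carrier to K)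
  open RingProperties ring using (-‿distribˡ-*; -‿distribʳ-*; -1*x≈-x)
  open GroupProperties +-group using (ε⁻¹≈ε; //-rightDividesˡ; \\-leftDividesˡ; \\-leftDividesʳ)
  open AbelianGroupProperties +-abelianGroup using (⁻¹-∙-comm)
  open CommutativeSemigroupProperties +-commutativeSemigroup using (interchange; x∙yz≈y∙xz)
  open import Relation.Binary.Reasoning.Setoid setoid

  sub-mul : ∀ x y a → (x - y) * a ≈ x * a - y * a
  sub-mul x y a = trans (distribʳ a x (- y)) (+-congˡ (sym (-‿distribˡ-* y a)))

  mul-sub : ∀ a x y → a * (x - y) ≈ a * x - a * y
  mul-sub a x y = trans (distribˡ a x (- y)) (+-congˡ (sym (-‿distribʳ-* a y)))

  sub-cancelʳ : ∀ a b c → (a + c) - (b + c) ≈ a - b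
  sub-cancelʳ a b c = begin
    (a + c) - (b + c)      ≈⟨ +-congˡ (sym (⁻¹-∙-comm b c)) ⟩
    (a + c) + (- b + - c)  ≈⟨ interchange _ _ _ _ ⟩
    (a - b) + (c - c)      ≈⟨ +-congˡ (-‿inverseʳ c) ⟩
    (a - b) + 0#           ≈⟨ +-identityʳ _ ⟩
    a - b                  ∎

  eliminate-pivot : ∀ c r m l s → - m + s ≈ c * r + l → - c * r + s ≈ m + l
  eliminate-pivot c r m l s -m+s≈ = begin
    - c * r + s                  ≈⟨ +-cong (sym (-‿distribˡ-* c r)) (sym (\\-leftDividesˡ m s)) ⟩
    - (c * r) + (m + (- m + s))  ≈⟨ +-congˡ (+-congˡ -m+s≈) ⟩
    - (c * r) + (m + (c * r + l))  ≈⟨ x∙yz≈y∙xz _ _ _ ⟩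
    m + (- (c * r) + (c * r + l))  ≈⟨ +-congˡ (\\-leftDividesʳ (c * r) l) ⟩
    m + l                          ∎

  sumK-cong : ∀ {k} {f g : Fin k → K} → (∀ i → f i ≈ g i) → sumK f ≈ sumK g
  sumK-cong {zero}  f≈g = refl
  sumK-cong {suc k} f≈g = +-cong (f≈g zero) (sumK-cong (f≈g ∘ suc))

  sumK-+ : ∀ {k} (f g : Fin k → K) → sumK (λ i → f i + g i) ≈ sumK f + sumK g
  sumK-+ {zero}  f g = sym (+-identityˡ 0#)
  sumK-+ {suc k} f g = trans (+-congˡ (sumK-+ (f ∘ suc) (g ∘ suc))) (interchange _ _ _ _)

  sumK-*ˡ : ∀ {k} a (f : Fin k → K) → sumK (λ i → a * f i) ≈ a * sumK f
  sumK-*ˡ {zero}  a f = sym (zeroʳ a)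
  sumK-*ˡ {suc k} a f = trans (+-congˡ (sumK-*ˡ a (f ∘ suc))) (sym (distribˡ a _ _))

  sumK-*ʳ : ∀ {k} (f : Fin k → K) a → sumK (λ i → f i * a) ≈ sumK f * a
  sumK-*ʳ f a = trans (sumK-cong (λ i → *-comm (f i) a)) (trans (sumK-*ˡ a f) (*-comm a _))

  sumK-neg : ∀ {k} (f : Fin k → K) → sumK (λ i → - f i) ≈ - sumK f
  sumK-neg {zero}  f = sym ε⁻¹≈ε
  sumK-neg {suc k} f = trans (+-congˡ (sumK-neg (f ∘ suc))) (⁻¹-∙-comm _ _)

  sumK-sub : ∀ {k} (f g : Fin k → K) → sumK (λ i → f i - g i) ≈ sumK f - sumK g
  sumK-sub f g = trans (sumK-+ f (λ i → - g i)) (+-congˡ (sumK-neg g))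

  sumK-zero : ∀ {k} (f : Fin k → K) → (∀ i → f i ≈ 0#) → sumK f ≈ 0#
  sumK-zero {zero}  f f≈0 = refl
  sumK-zero {suc k} f f≈0 = trans (+-cong (f≈0 zero) (sumK-zero (f ∘ suc) (f≈0 ∘ suc))) (+-identityˡ 0#)

  sumK-punchIn : ∀ {k} (j : Fin (suc k)) (f : Fin (suc k) → K) →
                 sumK f ≈ f j + sumK (f ∘ punchIn j)
  sumK-punchIn zero    f = refl
  sumK-punchIn {suc k} (suc j) f = trans (+-congˡ (sumK-punchIn j (f ∘ suc))) (x∙yz≈y∙xz _ _ _)

  sumK-++ : ∀ {a b} (f : Fin (a ℕ.+ b) → K) → sumK f ≈ sumK (λ i → f (i ↑ˡ b)) + sumK (λ i → f (a ↑ʳ i))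
  sumK-++ {zero}  f = sym (+-identityˡ _)
  sumK-++ {suc a} f = trans (+-congˡ (sumK-++ {a} (f ∘ suc))) (sym (+-assoc _ _ _))

  δ : ∀ {k} → Fin k → Fin k → K
  δ zero    zero    = 1#
  δ zero    (suc _) = 0#
  δ (suc _) zero    = 0#
  δ (suc i) (suc j) = δ i j

  δ-sym : ∀ {k} (i j : Fin k) → δ i j ≈ δ j i
  δ-sym zero    zero    = refl
  δ-sym zero    (suc j) = refl
  δ-sym (suc i) zero    = refl
  δ-sym (suc i) (suc j) = δ-sym i j

  sumK-δˡ : ∀ {k} (i : Fin k) (f : Fin k → K) → sumK (λ m → δ i m * f m) ≈ f i
  sumK-δˡ zero    f = trans (+-cong (*-identityˡ _) (sumK-zero _ (λ m → zeroˡ (f (suc m))))) (+-identityʳ _)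
  sumK-δˡ (suc i) f = trans (+-cong (zeroˡ _) (sumK-δˡ i (f ∘ suc))) (+-identityˡ _)

  sumK-δʳ : ∀ {k} (i : Fin k) (f : Fin k → K) → sumK (λ m → f m * δ m i) ≈ f i
  sumK-δʳ i f = trans (sumK-cong (λ m → trans (*-comm _ _) (*-congʳ (δ-sym m i)))) (sumK-δˡ i f)

  infixl 7 _·_
  _·_ : ∀ {n} → K → Point n → Point n
  (a · v) j = a * v j

  infixl 6 _⊖_
  _⊖_ : ∀ {n} → Point n → Point n → Point n
  (u ⊖ v) j = u j - v j

  ≋-refl : ∀ {n} {u : Point n} → u ≋ u
  ≋-refl j = refl

  ≋-sym : ∀ {n} {u v : Point n} → u ≋ v → v ≋ u
  ≋-sym u≋v j = sym (u≋v j)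

  ≋-trans : ∀ {n} {u v w : Point n} → u ≋ v → v ≋ w → u ≋ w
  ≋-trans u≋v v≋w j = trans (u≋v j) (v≋w j)

  lincomb-cong : ∀ {k n} {c c′ : Fin k → K} {b b′ : Fin k → Point n} →
                 (∀ i → c i ≈ c′ i) → (∀ i → b i ≋ b′ i) → lincomb c b ≋ lincomb c′ b′
  lincomb-cong c≈c′ b≋b′ j = sumK-cong (λ i → *-cong (c≈c′ i) (b≋b′ i j))

  lincomb-+ : ∀ {k n} (c d : Fin k → K) (b : Fin k → Point n) →
              lincomb (λ i → c i + d i) b ≋ (lincomb c b ⊕ lincomb d b)
  lincomb-+ c d b j =
    trans (sumK-cong (λ i → distribʳ (b i j) (c i) (d i))) (sumK-+ (λ i → c i * b i j) (λ i → d i * b i j))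

  lincomb-* : ∀ {k n} a (c : Fin k → K) (b : Fin k → Point n) →
              lincomb (λ i → a * c i) b ≋ (a · lincomb c b)
  lincomb-* a c b j = trans (sumK-cong (λ i → *-assoc a (c i) (b i j))) (sumK-*ˡ a (λ i → c i * b i j))

  lincomb-sub : ∀ {k n} (c d : Fin k → K) a (b : Fin k → Point n) →
                lincomb (λ i → c i - a * d i) b ≋ (lincomb c b ⊖ a · lincomb d b)
  lincomb-sub c d a b j = begin
    sumK (λ i → (c i - a * d i) * b i j)
      ≈⟨ sumK-cong (λ i → trans (sub-mul (c i) (a * d i) (b i j))
                                (+-congˡ (-‿cong (*-assoc a (d i) (b i j))))) ⟩
    sumK (λ i → c i * b i j - a * (d i * b i j))
      ≈⟨ sumK-sub (λ i → c i * b i j) (λ i → a * (d i * b i j)) ⟩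
    lincomb c b j - sumK (λ i → a * (d i * b i j))
      ≈⟨ +-congˡ (-‿cong (sumK-*ˡ a (λ i → d i * b i j))) ⟩
    lincomb c b j - a * lincomb d b j ∎

  lincomb-zero : ∀ {k n} (c : Fin k → K) (b : Fin k → Point n) → (∀ i → c i ≈ 0#) → lincomb c b ≋ 0v
  lincomb-zero c b c≈0 j = sumK-zero _ (λ i → trans (*-congʳ (c≈0 i)) (zeroˡ _))

  lincomb-δ : ∀ {k n} (i : Fin k) (b : Fin k → Point n) → lincomb (δ i) b ≋ b i
  lincomb-δ i b j = sumK-δˡ i (λ m → b m j)

  lincomb-punchIn : ∀ {k n} (i : Fin (suc k)) (c : Fin (suc k) → K) (b : Fin (suc k) → Point n) →
                    c i ≈ 0# → lincomb c b ≋ lincomb (c ∘ punchIn i) (b ∘ punchIn i)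
  lincomb-punchIn i c b cᵢ≈0 j = begin
    lincomb c b j                                              ≈⟨ sumK-punchIn i (λ l → c l * b l j) ⟩
    c i * b i j + lincomb (c ∘ punchIn i) (b ∘ punchIn i) j  ≈⟨ +-congʳ (trans (*-congʳ cᵢ≈0) (zeroˡ _)) ⟩
    0# + lincomb (c ∘ punchIn i) (b ∘ punchIn i) j           ≈⟨ +-identityˡ _ ⟩
    lincomb (c ∘ punchIn i) (b ∘ punchIn i) j                ∎

  lincomb-++ : ∀ {a b n} (c : Fin (a ℕ.+ b) → K) (v : Fin a → Point n) (w : Fin b → Point n) →
               lincomb c (v ++ w) ≋ (lincomb (λ i → c (i ↑ˡ b)) v ⊕ lincomb (λ i → c (a ↑ʳ i)) w)
  lincomb-++ {a} {b} c v w j = trans (sumK-++ {a} (λ i → c i * (v ++ w) i j))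
    (+-cong (sumK-cong (λ i → *-congˡ (reflexive (≡.cong (λ z → z j) (lookup-++ˡ v w i)))))
            (sumK-cong (λ i → *-congˡ (reflexive (≡.cong (λ z → z j) (lookup-++ʳ v w i))))))

  _⊆-trans_ : ∀ {n} {A B C : PSet n} → A ⊆ B → B ⊆ C → A ⊆ C
  (A⊆B ⊆-trans B⊆C) v = B⊆C v ∘ A⊆B v

  ≐-refl : ∀ {n} {A : PSet n} → A ≐ A
  ≐-refl = (λ _ a → a) , (λ _ a → a)

  ≐-sym : ∀ {n} {A B : PSet n} → A ≐ B → B ≐ A
  ≐-sym (A⊆B , B⊆A) = B⊆A , A⊆B

  _≐-trans_ : ∀ {n} {A B C : PSet n} → A ≐ B → B ≐ C → A ≐ C
  (A⊆B , B⊆A) ≐-trans (B⊆C , C⊆B) = A⊆B ⊆-trans B⊆C , C⊆B ⊆-trans B⊆A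

  infixr 5 _⊆-trans_ _≐-trans_

  record IsLinear {n} (P : PSet n) : Set where
    field
      ∋-0v     : P 0v
      ⊕-closed : ∀ {u v} → P u → P v → P (u ⊕ v)
      ·-closed : ∀ a {v} → P v → P (a · v)
      ≋-resp   : ∀ {u v} → u ≋ v → P u → P v

    ⊖-closed : ∀ {u v} → P u → P v → P (u ⊖ v)
    ⊖-closed Pu Pv = ≋-resp (λ j → +-congˡ (-1*x≈-x _)) (⊕-closed Pu (·-closed (- 1#) Pv))

    lincomb-closed : ∀ {k} (b : Fin k → Point n) → (∀ i → P (b i)) → ∀ c → P (lincomb c b)
    lincomb-closed {zero}  b Pb c = ≋-resp (λ j → refl) ∋-0v
    lincomb-closed {suc k} b Pb c = ≋-resp (λ j → refl)
      (⊕-closed (·-closed (c zero) (Pb zero)) (lincomb-closed (b ∘ suc) (Pb ∘ suc) (c ∘ suc)))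

    Span-minimal : ∀ {k} (b : Fin k → Point n) → (∀ i → P (b i)) → Span b ⊆ P
    Span-minimal b Pb v (c , v≋) = ≋-resp (≋-sym v≋) (lincomb-closed b Pb c)

  open IsLinear public

  IsLinear-resp-≐ : ∀ {n} {P Q : PSet n} → P ≐ Q → IsLinear Q → IsLinear P
  IsLinear-resp-≐ (P⊆Q , Q⊆P) L = record
    { ∋-0v     = Q⊆P _ (∋-0v L)
    ; ⊕-closed = λ Pu Pv → Q⊆P _ (⊕-closed L (P⊆Q _ Pu) (P⊆Q _ Pv))
    ; ·-closed = λ a Pv → Q⊆P _ (·-closed L a (P⊆Q _ Pv))
    ; ≋-resp   = λ u≋v Pu → Q⊆P _ (≋-resp L u≋v (P⊆Q _ Pu))
    }

  Span-isLinear : ∀ {k n} (b : Fin k → Point n) → IsLinear (Span b)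
  Span-isLinear b = record
    { ∋-0v     = (λ _ → 0#) , ≋-sym (lincomb-zero _ b (λ _ → refl))
    ; ⊕-closed = λ (c , u≋) (d , v≋) → (λ i → c i + d i) ,
                   ≋-trans (λ j → +-cong (u≋ j) (v≋ j)) (≋-sym (lincomb-+ c d b))
    ; ·-closed = λ a (c , v≋) → (λ i → a * c i) , ≋-trans (λ j → *-congˡ (v≋ j)) (≋-sym (lincomb-* a c b))
    ; ≋-resp   = λ u≋v (c , u≋) → c , ≋-trans (≋-sym u≋v) u≋
    }

  Span-∋ : ∀ {k n} (b : Fin k → Point n) i → Span b (b i)
  Span-∋ b i = δ i , ≋-sym (lincomb-δ i b)

  Span-mono : ∀ {k k′ n} (b : Fin k → Point n) (b′ : Fin k′ → Point n) →
              (∀ j → Span b (b′ j)) → Span b′ ⊆ Span b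
  Span-mono b = Span-minimal (Span-isLinear b)

  Span-resp : ∀ {k n} {b b′ : Fin k → Point n} → (∀ i → b i ≋ b′ i) → Span b ⊆ Span b′
  Span-resp b≋b′ v (c , v≋) = c , ≋-trans v≋ (lincomb-cong (λ _ → refl) b≋b′)

  Independent-resp : ∀ {k n} {b b′ : Fin k → Point n} → (∀ i → b i ≋ b′ i) → Independent b → Independent b′
  Independent-resp b≋b′ indep c c·b′≋0 = indep c (≋-trans (lincomb-cong (λ _ → refl) b≋b′) c·b′≋0)

  Independent-tail : ∀ {k n} (b : Fin (suc k) → Point n) → Independent b → Independent (b ∘ suc)
  Independent-tail b indep d d·b≋0 m = indep (0# ∷ d) (λ j → trans (+-congʳ (zeroˡ _))
                                                       (trans (+-identityˡ _) (d·b≋0 j))) (suc m)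

  Span-punchIn-sub : ∀ {k n} (b : Fin (suc k) → Point n) (i : Fin (suc k)) (c d : Fin (suc k) → K) β →
                     d i ≈ β * c i → Span (b ∘ punchIn i) (lincomb d b ⊖ β · lincomb c b)
  Span-punchIn-sub b i c d β dᵢ≈ = (λ l → d (punchIn i l) - β * c (punchIn i l)) ,
    ≋-trans (≋-sym (lincomb-sub d c β b))
            (lincomb-punchIn i (λ l → d l - β * c l) b (trans (+-congʳ dᵢ≈) (-‿inverseʳ _)))

  Independent-shear : ∀ {k n} (b : Fin (suc k) → Point n) (β : Fin k → K) →
                      Independent b → Independent (λ m → b (suc m) ⊖ β m · b zero)
  Independent-shear b β indep d d·b′≋0 m = indep (- Σdβ ∷ d) c·b≋0 (suc m)
    where
    Σdβ = sumK (λ m → d m * β m)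
    c·b≋0 : lincomb (- Σdβ ∷ d) b ≋ 0v
    c·b≋0 j = begin
      - Σdβ * b zero j + sumK (λ m → d m * b (suc m) j)
        ≈⟨ +-comm _ _ ⟩
      sumK (λ m → d m * b (suc m) j) + - Σdβ * b zero j
        ≈⟨ +-congˡ (sym (-‿distribˡ-* _ _)) ⟩
      sumK (λ m → d m * b (suc m) j) - Σdβ * b zero j
        ≈⟨ +-congˡ (-‿cong (sym (sumK-*ʳ (λ m → d m * β m) (b zero j)))) ⟩
      sumK (λ m → d m * b (suc m) j) - sumK (λ m → d m * β m * b zero j)
        ≈⟨ sym (sumK-sub (λ m → d m * b (suc m) j) (λ m → d m * β m * b zero j)) ⟩
      sumK (λ m → d m * b (suc m) j - d m * β m * b zero j)
        ≈⟨ sumK-cong (λ m → trans (+-congˡ (-‿cong (*-assoc (d m) (β m) (b zero j))))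
                                  (sym (mul-sub (d m) (b (suc m) j) (β m * b zero j)))) ⟩
      lincomb d (λ m → b (suc m) ⊖ β m · b zero) j
        ≈⟨ d·b′≋0 j ⟩
      0# ∎

  coset-∋ : ∀ {n} {P : PSet n} → IsLinear P → ∀ y → (P +ₛ y) y
  coset-∋ L y = 0v , ∋-0v L , λ j → sym (+-identityˡ _)

  coset-diff : ∀ {n} {P : PSet n} → IsLinear P → ∀ {y a b} → (P +ₛ y) a → (P +ₛ y) b → P (a ⊖ b)
  coset-diff L (w , Pw , a≋) (w′ , Pw′ , b≋) =
    ≋-resp L (λ j → sym (trans (+-cong (a≋ j) (-‿cong (b≋ j))) (sub-cancelʳ _ _ _))) (⊖-closed L Pw Pw′)

  coset-shift : ∀ {n} {P : PSet n} → IsLinear P → ∀ {y z} → (P +ₛ y) z → (P +ₛ y) ≐ (P +ₛ z)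
  coset-shift L {y} {z} z∈@(w₀ , Pw₀ , z≋) =
    (λ v v∈ → v ⊖ z , coset-diff L v∈ z∈ , λ j → sym (//-rightDividesˡ (z j) (v j))) ,
    (λ v (w , Pw , v≋) → w ⊕ w₀ , ⊕-closed L Pw Pw₀ ,
       λ j → trans (v≋ j) (trans (+-congˡ (z≋ j)) (sym (+-assoc _ _ _))))

  coset-direction : ∀ {n} {P P′ : PSet n} → IsLinear P → IsLinear P′ → ∀ {y y′} →
                    (P +ₛ y) ⊆ (P′ +ₛ y′) → P ⊆ P′
  coset-direction L L′ {y} P+y⊆ v Pv = ≋-resp L′
    (λ j → trans (sub-cancelʳ (v j) 0# (y j)) (trans (+-congˡ ε⁻¹≈ε) (+-identityʳ _)))
    (coset-diff L′ (P+y⊆ _ (_ , Pv , ≋-refl)) (P+y⊆ _ (_ , ∋-0v L , ≋-refl)))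

  +ₛ-cong : ∀ {n} {P P′ : PSet n} y → P ≐ P′ → (P +ₛ y) ≐ (P′ +ₛ y)
  +ₛ-cong y (P⊆P′ , P′⊆P) = (λ v (w , Pw , v≋) → w , P⊆P′ w Pw , v≋) ,
                            (λ v (w , Pw , v≋) → w , P′⊆P w Pw , v≋)

  FlatFamilySize-↔ : ∀ {n k N} {I : Set} {Fam : PSet n → Set₁} (L : I → PSet n) → Fin N ↔ I →
                     (∀ i → IsFlat k (L i) × Fam (L i)) → (∀ i i′ → L i ≐ L i′ → i ≡ i′) →
                     (∀ A → IsFlat k A → Fam A → ∃ λ i → A ≐ L i) → FlatFamilySize k Fam N
  FlatFamilySize-↔ L N↔I members injective covers =
    L ∘ to , members ∘ to ,
    (λ j j′ Lj≐Lj′ → ≡.trans (≡.sym (strictlyInverseʳ j))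
                      (≡.trans (≡.cong from (injective _ _ Lj≐Lj′)) (strictlyInverseʳ j′))) ,
    λ A A-flat A∈ → let i , A≐Lᵢ = covers A A-flat A∈ in
      from i , ≡.subst (λ i → A ≐ L i) (≡.sym (strictlyInverseˡ i)) A≐Lᵢ
    where open Inverse N↔I

∀-or-∃¬ : ∀ {k} {P : Fin k → Set} → (∀ i → Dec (P i)) → (∀ i → P i) ⊎ ∃ λ i → ¬ P i
∀-or-∃¬ {k} {P} P? with Fin.all? P?
... | yes ∀P = inj₁ ∀P
... | no ¬∀P = inj₂ (Fin.¬∀⟶∃¬ k P P? ¬∀P)

funToFin-cong : ∀ {m n} {f g : Fin m → Fin n} → (∀ i → f i ≡ g i) → Fin.funToFin f ≡ Fin.funToFin g
funToFin-cong {zero}  f≗g = ≡.refl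
funToFin-cong {suc m} f≗g = ≡.cong₂ Fin.combine (f≗g zero) (funToFin-cong (f≗g ∘ suc))

∷-++ : ∀ {e t} {A : Set} (v : A) (w : Fin e → A) (u : Fin t → A) i → ((v ∷ w) ++ u) i ≡ (v ∷ (w ++ u)) i
∷-++ v w u zero = ≡.refl
∷-++ {e} v w u (suc i) with Fin.splitAt e i
... | inj₁ _ = ≡.refl
... | inj₂ _ = ≡.refl

module FiniteField (R : CommutativeRing 0ℓ 0ℓ) (isField : Geometry.IsField R)
                   (q : ℕ) (card : Geometry.HasCard R q) where
  open Geometry R
  open CommutativeRing R hiding (zero) renaming (Carrier to K)
  open LinearAlgebra R
  open RingProperties ring using (-‿distribˡ-*; -‿distribʳ-*)
  open GroupProperties +-group using (inverseˡ-unique; x∙y⁻¹≈ε⇒x≈y; //-rightDividesʳ)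
  open CommutativeSemigroupProperties +-commutativeSemigroup using (interchange)
  open import Relation.Binary.Reasoning.Setoid setoid

  enum : Fin q → K
  enum = proj₁ card

  enum-injective : ∀ i j → enum i ≈ enum j → i ≡ j
  enum-injective = proj₁ (proj₂ card)

  enum-surjective : ∀ a → ∃ λ i → enum i ≈ a
  enum-surjective = proj₂ (proj₂ card)

  _≈?_ : ∀ a b → Dec (a ≈ b)
  a ≈? b with enum-surjective a | enum-surjective b
  ... | i , eᵢ≈a | j , eⱼ≈b with i Fin.≟ j
  ... | yes ≡.refl = yes (trans (sym eᵢ≈a) eⱼ≈b)
  ... | no i≢j     = no λ a≈b → i≢j (enum-injective i j (trans eᵢ≈a (trans a≈b (sym eⱼ≈b))))

  1≉0 : ¬ 1# ≈ 0#
  1≉0 = proj₁ isField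

  inverse : ∀ a → ¬ a ≈ 0# → K
  inverse a a≉0 = proj₁ (proj₂ isField a a≉0)

  inverse-*ˡ : ∀ a (a≉0 : ¬ a ≈ 0#) → inverse a a≉0 * a ≈ 1#
  inverse-*ˡ a a≉0 = trans (*-comm _ _) (proj₂ (proj₂ isField a a≉0))

  solve-linear : ∀ c x y (c≉0 : ¬ c ≈ 0#) → c * x + y ≈ 0# → x ≈ - inverse c c≉0 * y
  solve-linear c x y c≉0 cx+y≈0 = begin
    x                               ≈⟨ sym (*-identityˡ x) ⟩
    1# * x                          ≈⟨ *-congʳ (sym (inverse-*ˡ c c≉0)) ⟩
    inverse c c≉0 * c * x           ≈⟨ *-assoc _ _ _ ⟩
    inverse c c≉0 * (c * x)         ≈⟨ *-congˡ (inverseˡ-unique _ _ cx+y≈0) ⟩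
    inverse c c≉0 * - y             ≈⟨ sym (-‿distribʳ-* _ _) ⟩
    - (inverse c c≉0 * y)           ≈⟨ -‿distribˡ-* _ _ ⟩
    - inverse c c≉0 * y             ∎

  ∃-coefficients? : ∀ {k} (P : (Fin k → K) → Set) → (∀ {c c′} → (∀ i → c i ≈ c′ i) → P c → P c′) →
                    (∀ c → Dec (P c)) → Dec (∃ P)
  ∃-coefficients? {zero} P resp P? with P? (λ ())
  ... | yes Pc = yes (_ , Pc)
  ... | no ¬Pc = no λ (c , Pc) → ¬Pc (resp (λ ()) Pc)
  ∃-coefficients? {suc k} P resp P?
    with Fin.any? (λ i → ∃-coefficients? (λ c → P (enum i ∷ c))
                           (λ c≈c′ → resp (λ { zero → refl ; (suc m) → c≈c′ m }))
                           (λ c → P? (enum i ∷ c)))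
  ... | yes (i , c , Pc) = yes (enum i ∷ c , Pc)
  ... | no ¬P = no λ (c , Pc) → let (i , eᵢ≈c₀) = enum-surjective (c zero) in
          ¬P (i , c ∘ suc , resp (λ { zero → sym eᵢ≈c₀ ; (suc m) → refl }) Pc)

  Span? : ∀ {k n} (b : Fin k → Point n) v → Dec (Span b v)
  Span? b v = ∃-coefficients? (λ c → v ≋ lincomb c b)
                (λ c≈c′ v≋ → ≋-trans v≋ (lincomb-cong c≈c′ (λ _ → ≋-refl)))
                (λ c → Fin.all? (λ j → v j ≈? lincomb c b j))

  Span-⊆-or-∉ : ∀ {k k′ n} (b : Fin k → Point n) (b′ : Fin k′ → Point n) →
                Span b′ ⊆ Span b ⊎ ∃ λ j → ¬ Span b (b′ j)
  Span-⊆-or-∉ b b′ with ∀-or-∃¬ (λ j → Span? b (b′ j))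
  ... | inj₁ b′∈ = inj₁ (Span-mono b b′ b′∈)
  ... | inj₂ b′ⱼ∉ = inj₂ b′ⱼ∉

  ¬Independent-zero-head : ∀ {k n} (b : Fin (suc k) → Point n) → b zero ≋ 0v → ¬ Independent b
  ¬Independent-zero-head b b₀≋0 indep = 1≉0 (indep (δ zero) (≋-trans (lincomb-δ zero b) b₀≋0) zero)

  Independent-∷ : ∀ {k n} (b : Fin k → Point n) (v : Point n) →
                  Independent b → ¬ Span b v → Independent (v ∷ b)
  Independent-∷ b v indep v∉ c c·vb≋0 with c zero ≈? 0#
  ... | yes c₀≈0 = λ { zero → c₀≈0 ; (suc m) → indep (c ∘ suc) c·b≋0 m }
    where
    c·b≋0 : lincomb (c ∘ suc) b ≋ 0v
    c·b≋0 j = trans (sym (+-identityˡ _))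
                    (trans (+-congʳ (sym (trans (*-congʳ c₀≈0) (zeroˡ _)))) (c·vb≋0 j))
  ... | no c₀≉0 = ⊥-elim (v∉ ((λ m → - inverse (c zero) c₀≉0 * c (suc m)) ,
        λ j → trans (solve-linear (c zero) (v j) _ c₀≉0 (c·vb≋0 j))
                    (sym (lincomb-* _ (c ∘ suc) b j))))

  -- Steinitz exchange: a pivot of b′ zero is eliminated from the other vectors, which then lie in a
  -- span of one vector fewer and stay independent.
  Span-suc⇒¬Independent : ∀ {n} k (b : Fin k → Point n) (b′ : Fin (suc k) → Point n) →
                          (∀ j → Span b (b′ j)) → ¬ Independent b′
  Span-suc⇒¬Independent zero b b′ b′∈ = ¬Independent-zero-head b′ (proj₂ (b′∈ zero))
  Span-suc⇒¬Independent {n} (suc k) b b′ b′∈ indep = pivot (∀-or-∃¬ (λ i → coeff zero i ≈? 0#))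
    where
    coeff : Fin (suc (suc k)) → Fin (suc k) → K
    coeff j = proj₁ (b′∈ j)
    pivot : (∀ i → coeff zero i ≈ 0#) ⊎ ∃ (λ i → ¬ coeff zero i ≈ 0#) → ⊥
    pivot (inj₁ c₀≈0) = ¬Independent-zero-head b′ (≋-trans (proj₂ (b′∈ zero)) (lincomb-zero _ b c₀≈0)) indep
    pivot (inj₂ (i , α≉0)) = Span-suc⇒¬Independent k (b ∘ punchIn i) b″ b″∈ (Independent-shear b′ β indep)
      where
      α = coeff zero i
      β : Fin (suc k) → K
      β m = coeff (suc m) i * inverse α α≉0
      b″ : Fin (suc k) → Point n
      b″ m = b′ (suc m) ⊖ β m · b′ zero
      cᵢ≈βα : ∀ m → coeff (suc m) i ≈ β m * α
      cᵢ≈βα m = sym (begin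
        coeff (suc m) i * inverse α α≉0 * α    ≈⟨ *-assoc _ _ _ ⟩
        coeff (suc m) i * (inverse α α≉0 * α)  ≈⟨ *-congˡ (inverse-*ˡ α α≉0) ⟩
        coeff (suc m) i * 1#                   ≈⟨ *-identityʳ _ ⟩
        coeff (suc m) i                        ∎)
      b″∈ : ∀ m → Span (b ∘ punchIn i) (b″ m)
      b″∈ m = ≋-resp (Span-isLinear (b ∘ punchIn i))
        (λ j → sym (+-cong (proj₂ (b′∈ (suc m)) j) (-‿cong (*-congˡ (proj₂ (b′∈ zero) j)))))
        (Span-punchIn-sub b i (coeff zero) (coeff (suc m)) (β m) (cᵢ≈βα m))

  Span-<⇒¬Independent : ∀ {n} k k′ → k ℕ.< k′ → (b : Fin k → Point n) (b′ : Fin k′ → Point n) →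
                        (∀ j → Span b (b′ j)) → ¬ Independent b′
  Span-<⇒¬Independent {n} k k′ k<k′ b b′ b′∈ with ℕ.m≤n⇒∃[o]m+o≡n k<k′
  ... | r , k+r≡k′ = dropHeads r (≡.trans (ℕ.+-comm r (suc k)) k+r≡k′) b′ b′∈
    where
    dropHeads : ∀ r {k″} → r ℕ.+ suc k ≡ k″ → (b′ : Fin k″ → Point n) →
                (∀ j → Span b (b′ j)) → ¬ Independent b′
    dropHeads zero    ≡.refl b′ b′∈ = Span-suc⇒¬Independent k b b′ b′∈
    dropHeads (suc r) ≡.refl b′ b′∈ = dropHeads r ≡.refl (b′ ∘ suc) (b′∈ ∘ suc) ∘ Independent-tail b′

  sameDimension-⊆⇒⊇ : ∀ {k n} (b b′ : Fin k → Point n) → Independent b → Independent b′ →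
                      Span b′ ⊆ Span b → Span b ⊆ Span b′
  sameDimension-⊆⇒⊇ {k} b b′ indep indep′ b′⊆b v v∈ with Span? b′ v
  ... | yes v∈′ = v∈′
  ... | no v∉′ = ⊥-elim (Span-suc⇒¬Independent k b (v ∷ b′)
                   (λ { zero → v∈ ; (suc m) → b′⊆b _ (Span-∋ b′ m) })
                   (Independent-∷ b′ v indep′ v∉′))

  extendBasis : ∀ {t n} (u : Fin t → Point n) → Independent u → ∀ {r} (vs : Fin r → Point n) →
                Σ ℕ λ e → Σ (Fin e → Point n) λ w → Independent (w ++ u) × (∀ k → Span (w ++ u) (vs k))
  extendBasis u indep {zero} vs = 0 , (λ ()) , indep , λ ()
  extendBasis u indep {suc r} vs with extendBasis u indep (vs ∘ suc)
  ... | e , w , indep′ , vs∈ with Span? (w ++ u) (vs zero)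
  ...   | yes v∈ = e , w , indep′ , λ { zero → v∈ ; (suc k) → vs∈ k }
  ...   | no v∉ =
    suc e , v ∷ w , Independent-resp ∷-++≋ (Independent-∷ (w ++ u) v indep′ v∉) ,
    λ { zero → Span-resp ∷-++≋ _ (Span-∋ b zero)
      ; (suc k) → Span-resp ∷-++≋ _ (Span-mono b (w ++ u) (Span-∋ b ∘ suc) _ (vs∈ k)) }
    where
    v = vs zero
    b = v ∷ (w ++ u)
    ∷-++≋ : ∀ i → b i ≋ ((v ∷ w) ++ u) i
    ∷-++≋ i j = reflexive (≡.cong (λ z → z j) (≡.sym (∷-++ v w u i)))

  standard : ∀ {n} → Fin n → Point n
  standard = δ

  Span-standard : ∀ {n} (v : Point n) → Span standard v
  Span-standard v = v , λ j → sym (sumK-δʳ j v)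

  Independent-standard : ∀ {n} → Independent (standard {n})
  Independent-standard c c·e≋0 j = trans (sym (sumK-δʳ j c)) (c·e≋0 j)

  -- w extends u to a basis of K^n; π v are the w-coordinates of v, i.e. coordinates of v modulo Span u.
  module Complement {t n} (u : Fin t → Point n) (indep : Independent u) where
    -- Opaque so that conversion checking never unfolds the search performed by extendBasis.
    opaque
      extension : Σ ℕ λ e → Σ (Fin e → Point n) λ w → Independent (w ++ u) × (∀ k → Span (w ++ u) (standard k))
      extension = extendBasis u indep standard

    e : ℕ
    e = proj₁ extension

    w : Fin e → Point n
    w = proj₁ (proj₂ extension)

    private
      basis : Fin (e ℕ.+ t) → Point n
      basis = w ++ u

      basis-independent : Independent basis
      basis-independent = proj₁ (proj₂ (proj₂ extension))

      basis-spans : ∀ k → Span basis (standard k)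
      basis-spans = proj₂ (proj₂ (proj₂ extension))

      coordinates : ∀ v → Span basis v
      coordinates v = Span-mono basis standard basis-spans v (Span-standard v)

    dimension : e ℕ.+ t ≡ n
    dimension with ℕ.<-cmp (e ℕ.+ t) n
    ... | tri< e+t<n _ _ =
      ⊥-elim (Span-<⇒¬Independent (e ℕ.+ t) n e+t<n basis standard basis-spans Independent-standard)
    ... | tri≈ _ e+t≡n _ = e+t≡n
    ... | tri> _ _ e+t>n =
      ⊥-elim (Span-<⇒¬Independent n (e ℕ.+ t) e+t>n standard basis (Span-standard ∘ basis) basis-independent)

    π : Point n → Fin e → K
    π v i = proj₁ (coordinates v) (i ↑ˡ t)

    σ : (Fin e → K) → Point n
    σ a = lincomb a w

    private
      remainder : Point n → Point n
      remainder v = lincomb (λ i → proj₁ (coordinates v) (e ↑ʳ i)) u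

      remainder-∈ : ∀ v → Span u (remainder v)
      remainder-∈ v = _ , ≋-refl

      decompose : ∀ v → v ≋ (σ (π v) ⊕ remainder v)
      decompose v = ≋-trans (proj₂ (coordinates v)) (lincomb-++ (proj₁ (coordinates v)) w u)

    π-unique : ∀ v a y → Span u y → v ≋ (σ a ⊕ y) → ∀ i → π v i ≈ a i
    π-unique v a y (d , y≋) v≋ i = begin
      c (i ↑ˡ t)                ≈⟨ x∙y⁻¹≈ε⇒x≈y _ _ (basis-independent _ c′·basis≋0 (i ↑ˡ t)) ⟩
      1# * (a ++ d) (i ↑ˡ t)    ≈⟨ *-identityˡ _ ⟩
      (a ++ d) (i ↑ˡ t)         ≡⟨ lookup-++ˡ a d i ⟩
      a i                       ∎
      where
      c = proj₁ (coordinates v)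
      ad·basis≋ : lincomb (a ++ d) basis ≋ (σ a ⊕ lincomb d u)
      ad·basis≋ = ≋-trans (lincomb-++ (a ++ d) w u)
        (λ j → +-cong (lincomb-cong {b = w} (λ l → reflexive (lookup-++ˡ a d l)) (λ _ → ≋-refl) j)
                      (lincomb-cong {b = u} (λ l → reflexive (lookup-++ʳ a d l)) (λ _ → ≋-refl) j))
      v≋ad·basis : v ≋ lincomb (a ++ d) basis
      v≋ad·basis = ≋-trans v≋ (≋-trans (λ j → +-congˡ (y≋ j)) (≋-sym ad·basis≋))
      c′·basis≋0 : lincomb (λ l → c l - 1# * (a ++ d) l) basis ≋ 0v
      c′·basis≋0 = ≋-trans (lincomb-sub c (a ++ d) 1# basis)
        (λ j → trans (+-congˡ (-‿cong (trans (*-identityˡ _) (trans (sym (v≋ad·basis j)) (proj₂ (coordinates v) j)))))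
                     (-‿inverseʳ _))

    π-cong : ∀ {v v′} → v ≋ v′ → ∀ i → π v i ≈ π v′ i
    π-cong {v} {v′} v≋v′ i =
      sym (π-unique v′ (π v) (remainder v) (remainder-∈ v) (≋-trans (≋-sym v≋v′) (decompose v)) i)

    π-Span : ∀ y → Span u y → ∀ i → π y i ≈ 0#
    π-Span y y∈ = π-unique y (λ _ → 0#) y y∈
      (λ j → sym (trans (+-congʳ (lincomb-zero _ w (λ _ → refl) j)) (+-identityˡ _)))

    π-σ : ∀ a i → π (σ a) i ≈ a i
    π-σ a = π-unique (σ a) a 0v (∋-0v (Span-isLinear u)) (λ j → sym (+-identityʳ _))

    π-linear : ∀ α v v′ i → π ((α · v) ⊕ v′) i ≈ α * π v i + π v′ i
    π-linear α v v′ = π-unique _ (λ i → α * π v i + π v′ i) ((α · remainder v) ⊕ remainder v′)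
      (⊕-closed U (·-closed U α (remainder-∈ v)) (remainder-∈ v′))
      λ j → begin
        α * v j + v′ j
          ≈⟨ +-cong (*-congˡ (decompose v j)) (decompose v′ j) ⟩
        α * (σ (π v) j + remainder v j) + (σ (π v′) j + remainder v′ j)
          ≈⟨ +-congʳ (distribˡ _ _ _) ⟩
        (α * σ (π v) j + α * remainder v j) + (σ (π v′) j + remainder v′ j)
          ≈⟨ interchange _ _ _ _ ⟩
        (α * σ (π v) j + σ (π v′) j) + (α * remainder v j + remainder v′ j)
          ≈⟨ +-congʳ (sym (trans (lincomb-+ (λ i → α * π v i) (π v′) w j)
                                 (+-congʳ (lincomb-* α (π v) w j)))) ⟩
        σ (λ i → α * π v i + π v′ i) j + (α * remainder v j + remainder v′ j) ∎
      where U = Span-isLinear u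

    π-kernel : ∀ v → (∀ i → π v i ≈ 0#) → Span u v
    π-kernel v πv≈0 = ≋-resp (Span-isLinear u)
      (λ j → sym (trans (decompose v j) (trans (+-congʳ (lincomb-zero (π v) w πv≈0 j)) (+-identityˡ _))))
      (remainder-∈ v)

  vector : ∀ m → Fin (q ℕ.^ m) → Fin m → K
  vector m j = enum ∘ Fin.finToFun j

  vector-injective : ∀ m (j j′ : Fin (q ℕ.^ m)) → (∀ i → vector m j i ≈ vector m j′ i) → j ≡ j′
  vector-injective m j j′ j≈j′ =
    ≡.trans (≡.sym (Fin.funToFin-finToFin {m} {q} j))
      (≡.trans (funToFin-cong (λ i → enum-injective _ _ (j≈j′ i))) (Fin.funToFin-finToFin {m} {q} j′))

  vector-surjective : ∀ m (v : Fin m → K) → ∃ λ j → ∀ i → vector m j i ≈ v i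
  vector-surjective m v = Fin.funToFin index , λ i →
    trans (reflexive (≡.cong enum (Fin.finToFun-funToFin index i))) (proj₂ (enum-surjective (v i)))
    where
    index : Fin m → Fin q
    index = proj₁ ∘ enum-surjective ∘ v

  -- A line of K^(suc m) has a representative 1 ∷ v (q ^ m choices) or 0 ∷ r with r representing a
  -- line of K^m; this is the recursion gauss1 q (suc m) = q ^ m + gauss1 q m.
  lineRep : ∀ m → Fin (gauss1 q m) → Fin m → K
  lineRep⊎ : ∀ m → Fin (q ℕ.^ m) ⊎ Fin (gauss1 q m) → Fin (suc m) → K
  lineRep⊎ m (inj₁ a) = 1# ∷ vector m a
  lineRep⊎ m (inj₂ b) = 0# ∷ lineRep m b
  lineRep zero ()
  lineRep (suc m) j = lineRep⊎ m (Fin.splitAt (q ℕ.^ m) j)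

  lineRep-join : ∀ m s i → lineRep (suc m) (Fin.join (q ℕ.^ m) (gauss1 q m) s) i ≈ lineRep⊎ m s i
  lineRep-join m s i = reflexive (≡.cong (λ s′ → lineRep⊎ m s′ i) (Fin.splitAt-join (q ℕ.^ m) (gauss1 q m) s))

  lineRep-nonzero : ∀ m j → ¬ (∀ i → lineRep m j i ≈ 0#)
  lineRep⊎-nonzero : ∀ m s → ¬ (∀ i → lineRep⊎ m s i ≈ 0#)
  lineRep-nonzero (suc m) j = lineRep⊎-nonzero m (Fin.splitAt (q ℕ.^ m) j)
  lineRep⊎-nonzero m (inj₁ a) ≈0 = 1≉0 (≈0 zero)
  lineRep⊎-nonzero m (inj₂ b) ≈0 = lineRep-nonzero m b (≈0 ∘ suc)

  lineRep-proportional : ∀ m j j′ μ → (∀ i → lineRep m j′ i ≈ μ * lineRep m j i) → j ≡ j′ × μ ≈ 1#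
  lineRep⊎-proportional : ∀ m s s′ μ → (∀ i → lineRep⊎ m s′ i ≈ μ * lineRep⊎ m s i) → s ≡ s′ × μ ≈ 1#
  lineRep-proportional (suc m) j j′ μ j′≈μj
    with lineRep⊎-proportional m (Fin.splitAt (q ℕ.^ m) j) (Fin.splitAt (q ℕ.^ m) j′) μ j′≈μj
  ... | s≡s′ , μ≈1 = ≡.trans (≡.sym (Fin.join-splitAt (q ℕ.^ m) _ j))
                      (≡.trans (≡.cong (Fin.join (q ℕ.^ m) _) s≡s′) (Fin.join-splitAt (q ℕ.^ m) _ j′)) , μ≈1
  lineRep⊎-proportional m (inj₁ a) (inj₁ a′) μ a′≈μa =
    ≡.cong inj₁ (vector-injective m a a′ λ i →
      sym (trans (a′≈μa (suc i)) (trans (*-congʳ μ≈1) (*-identityˡ _))))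
    , μ≈1
    where μ≈1 = sym (trans (a′≈μa zero) (*-identityʳ μ))
  lineRep⊎-proportional m (inj₁ a) (inj₂ b′) μ b′≈μa =
    ⊥-elim (lineRep-nonzero m b′ λ i → trans (b′≈μa (suc i)) (trans (*-congʳ μ≈0) (zeroˡ _)))
    where μ≈0 = sym (trans (b′≈μa zero) (*-identityʳ μ))
  lineRep⊎-proportional m (inj₂ b) (inj₁ a′) μ a′≈μb = ⊥-elim (1≉0 (trans (a′≈μb zero) (zeroʳ μ)))
  lineRep⊎-proportional m (inj₂ b) (inj₂ b′) μ b′≈μb with lineRep-proportional m b b′ μ (b′≈μb ∘ suc)
  ... | b≡b′ , μ≈1 = ≡.cong inj₂ b≡b′ , μ≈1

  lineRep-normalize : ∀ m (v : Fin m → K) → ¬ (∀ i → v i ≈ 0#) →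
                      Σ K λ μ → ∃ λ j → ∀ i → lineRep m j i ≈ μ * v i
  lineRep-normalize zero v v≉0 = ⊥-elim (v≉0 (λ ()))
  lineRep-normalize (suc m) v v≉0 with v zero ≈? 0#
  ... | no v₀≉0 = μ , Fin.join (q ℕ.^ m) (gauss1 q m) (inj₁ a) ,
                  λ i → trans (lineRep-join m (inj₁ a) i) (rep≈ i)
    where
    μ = inverse (v zero) v₀≉0
    a = proj₁ (vector-surjective m (λ i → μ * v (suc i)))
    rep≈ : ∀ i → lineRep⊎ m (inj₁ a) i ≈ μ * v i
    rep≈ zero    = sym (inverse-*ˡ _ v₀≉0)
    rep≈ (suc i) = proj₂ (vector-surjective m (λ i → μ * v (suc i))) i
  ... | yes v₀≈0 with lineRep-normalize m (v ∘ suc) (λ v′≈0 → v≉0 λ { zero → v₀≈0 ; (suc i) → v′≈0 i })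
  ...   | μ , b , b≈μv′ = μ , Fin.join (q ℕ.^ m) (gauss1 q m) (inj₂ b) ,
                          λ i → trans (lineRep-join m (inj₂ b) i) (rep≈ i)
    where
    rep≈ : ∀ i → lineRep⊎ m (inj₂ b) i ≈ μ * v i
    rep≈ zero    = sym (trans (*-congˡ v₀≈0) (zeroʳ μ))
    rep≈ (suc i) = b≈μv′ i

  Q : ℕ
  Q = q ℕ.^ 2 ℕ.+ q ℕ.+ 1

  module F3Count (n : ℕ) (U′ : PSet n) (U′-subspace : IsSubspace 3 U′) (x : Point n)
                 (S : Fin Q → PSet n) (S-subspace : ∀ i → IsSubspace 2 (S i)) (S⊆U′ : ∀ i → S i ⊆ U′)
                 (S-injective : ∀ i j → S i ≐ S j → i ≡ j)
                 (s : Fin Q → Point n) (s∈U : ∀ i → (U′ +ₛ x) (s i)) where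
    u : Fin 3 → Point n
    u = proj₁ U′-subspace

    u-independent : Independent u
    u-independent = proj₁ (proj₂ U′-subspace)

    U′≐ : U′ ≐ Span u
    U′≐ = proj₂ (proj₂ U′-subspace)

    U′-linear : IsLinear U′
    U′-linear = IsLinear-resp-≐ U′≐ (Span-isLinear u)

    bS : Fin Q → Fin 2 → Point n
    bS i = proj₁ (S-subspace i)

    bS-independent : ∀ i → Independent (bS i)
    bS-independent i = proj₁ (proj₂ (S-subspace i))

    S≐ : ∀ i → S i ≐ Span (bS i)
    S≐ i = proj₂ (proj₂ (S-subspace i))

    S-linear : ∀ i → IsLinear (S i)
    S-linear i = IsLinear-resp-≐ (S≐ i) (Span-isLinear (bS i))

    S⊆Span-u : ∀ i → Span (bS i) ⊆ Span u
    S⊆Span-u i = proj₂ (S≐ i) ⊆-trans S⊆U′ i ⊆-trans proj₁ U′≐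

    open Complement u u-independent public

    -- Opaque for the same reason as extension: u∉S is found by a search over coefficients.
    opaque
      u∉S : ∀ i → ∃ λ k → ¬ Span (bS i) (u k)
      u∉S i with Span-⊆-or-∉ (bS i) u
      ... | inj₁ u⊆S = ⊥-elim (Span-suc⇒¬Independent 2 (bS i) u (λ k → u⊆S _ (Span-∋ u k)) u-independent)
      ... | inj₂ uₖ∉S = uₖ∉S

    r : Fin Q → Point n
    r i = u (proj₁ (u∉S i))

    Span-u⊆ : ∀ i → Span u ⊆ Span (r i ∷ bS i)
    Span-u⊆ i = sameDimension-⊆⇒⊇ u (r i ∷ bS i) u-independent
      (Independent-∷ (bS i) (r i) (bS-independent i) (proj₂ (u∉S i)))
      (Span-mono u (r i ∷ bS i) λ { zero → Span-∋ u _ ; (suc k) → S⊆Span-u i _ (Span-∋ (bS i) k) })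

    g : ℕ
    g = gauss1 q e

    direction : Fin Q → Fin q → Fin g → Point n
    direction i a t = (enum a · r i) ⊕ σ (lineRep e t)

    planeBasis : Fin Q → Fin q → Fin g → Fin 3 → Point n
    planeBasis i a t = direction i a t ∷ bS i

    plane : Fin Q → Fin q → Fin g → PSet n
    plane i a t = Span (planeBasis i a t)

    flat : Fin Q → Fin q → Fin g → PSet n
    flat i a t = plane i a t +ₛ s i

    plane-linear : ∀ i a t → IsLinear (plane i a t)
    plane-linear i a t = Span-isLinear (planeBasis i a t)

    plane∋direction : ∀ i a t → plane i a t (direction i a t)
    plane∋direction i a t = Span-∋ (planeBasis i a t) zero

    π-direction : ∀ i a t k → π (direction i a t) k ≈ lineRep e t k
    π-direction i a t k = begin
      π (direction i a t) k                              ≈⟨ π-linear (enum a) (r i) (σ (lineRep e t)) k ⟩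
      enum a * π (r i) k + π (σ (lineRep e t)) k         ≈⟨ +-cong (*-congˡ (π-Span (r i) (Span-∋ u _) k))
                                                                   (π-σ (lineRep e t) k) ⟩
      enum a * 0# + lineRep e t k                        ≈⟨ +-congʳ (zeroʳ _) ⟩
      0# + lineRep e t k                                 ≈⟨ +-identityˡ _ ⟩
      lineRep e t k                                      ∎

    direction∉U : ∀ i a t → ¬ Span u (direction i a t)
    direction∉U i a t d∈U = lineRep-nonzero e t λ k → trans (sym (π-direction i a t k)) (π-Span _ d∈U k)

    planeBasis-independent : ∀ i a t → Independent (planeBasis i a t)
    planeBasis-independent i a t = Independent-∷ (bS i) (direction i a t) (bS-independent i)
                                     (direction∉U i a t ∘ S⊆Span-u i _)

    S⊆plane : ∀ i a t → S i ⊆ plane i a t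
    S⊆plane i a t = proj₁ (S≐ i) ⊆-trans Span-mono (planeBasis i a t) (bS i) (Span-∋ (planeBasis i a t) ∘ suc)

    flat-F3 : ∀ i a t → F3Family S s (flat i a t)
    flat-F3 i a t = (plane i a t , s i , (planeBasis i a t , planeBasis-independent i a t , ≐-refl) , ≐-refl) ,
                    i , λ v (w , Sw , v≋) → w , S⊆plane i a t w Sw , v≋

    U-F3 : F3Family S s (U′ +ₛ x)
    U-F3 = (U′ , x , U′-subspace , ≐-refl) , i₀ ,
           λ v (w , Sw , v≋) → proj₂ (coset-shift U′-linear (s∈U i₀)) v (w , S⊆U′ i₀ w Sw , v≋)
      where
      i₀ : Fin Q
      i₀ = ≡.subst Fin (ℕ.+-comm 1 (q ℕ.^ 2 ℕ.+ q)) zero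

    flat≉U : ∀ i a t → ¬ flat i a t ≐ (U′ +ₛ x)
    flat≉U i a t flat≐U = direction∉U i a t (proj₁ U′≐ _
      (coset-direction (plane-linear i a t) U′-linear (proj₁ flat≐U) _ (plane∋direction i a t)))

    distinct-S-span-U : ∀ i i′ → i ≢ i′ → ∀ {P} → IsLinear P → S i ⊆ P → S i′ ⊆ P → Span u ⊆ P
    distinct-S-span-U i i′ i≢i′ {P} P-linear Sᵢ⊆P Sᵢ′⊆P with Span-⊆-or-∉ (bS i) (bS i′)
    ... | inj₁ Sᵢ′⊆Sᵢ = ⊥-elim (i≢i′ (S-injective i i′
          (S≐ i ≐-trans (Sᵢ⊆Sᵢ′ , Sᵢ′⊆Sᵢ) ≐-trans ≐-sym (S≐ i′))))
      where
      Sᵢ⊆Sᵢ′ = sameDimension-⊆⇒⊇ (bS i) (bS i′) (bS-independent i) (bS-independent i′) Sᵢ′⊆Sᵢ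
    ... | inj₂ (k , v∉Sᵢ) =
      sameDimension-⊆⇒⊇ u b u-independent (Independent-∷ (bS i) v (bS-independent i) v∉Sᵢ) (Span-mono u b b∈U)
        ⊆-trans Span-minimal P-linear b b∈P
      where
      v = bS i′ k
      b = v ∷ bS i
      b∈U : ∀ m → Span u (b m)
      b∈U zero    = S⊆Span-u i′ _ (Span-∋ (bS i′) k)
      b∈U (suc m) = S⊆Span-u i _ (Span-∋ (bS i) m)
      b∈P : ∀ m → P (b m)
      b∈P zero    = Sᵢ′⊆P _ (proj₂ (S≐ i′) _ (Span-∋ (bS i′) k))
      b∈P (suc m) = Sᵢ⊆P _ (proj₂ (S≐ i) _ (Span-∋ (bS i) m))

    direction∈plane : ∀ i a t a′ t′ → plane i a t (direction i a′ t′) → a ≡ a′ × t ≡ t′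
    direction∈plane i a t a′ t′ (c , d′≋) with lineRep-proportional e t t′ (c zero) lineRep-t′≈
      where
      lineRep-t′≈ : ∀ k → lineRep e t′ k ≈ c zero * lineRep e t k
      lineRep-t′≈ k = begin
        lineRep e t′ k                                         ≈⟨ π-direction i a′ t′ k ⟨
        π (direction i a′ t′) k                                ≈⟨ π-cong d′≋ k ⟩
        π ((c zero · direction i a t) ⊕ lincomb (c ∘ suc) (bS i)) k
          ≈⟨ π-linear (c zero) (direction i a t) _ k ⟩
        c zero * π (direction i a t) k + π (lincomb (c ∘ suc) (bS i)) k
          ≈⟨ +-cong (*-congˡ (π-direction i a t k)) (π-Span _ (S⊆Span-u i _ (c ∘ suc , ≋-refl)) k) ⟩
        c zero * lineRep e t k + 0#                            ≈⟨ +-identityʳ _ ⟩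
        c zero * lineRep e t k                                 ∎
    ... | ≡.refl , c₀≈1 = a≡a′ (d ≈? 0#) , ≡.refl
      where
      Lc = lincomb (c ∘ suc) (bS i)
      d = enum a′ - enum a
      d·rᵢ∈S : Span (bS i) (d · r i)
      d·rᵢ∈S = c ∘ suc , λ j → begin
        d * r i j                                                 ≈⟨ sub-mul _ _ _ ⟩
        enum a′ * r i j - enum a * r i j                          ≈⟨ sub-cancelʳ _ _ _ ⟨
        direction i a′ t j - direction i a t j                    ≈⟨ +-congʳ (d′≋ j) ⟩
        (c zero * direction i a t j + Lc j) - direction i a t j
          ≈⟨ +-congʳ (+-congʳ (trans (*-congʳ c₀≈1) (*-identityˡ _))) ⟩
        (direction i a t j + Lc j) - direction i a t j            ≈⟨ +-congʳ (+-comm _ _) ⟩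
        (Lc j + direction i a t j) - direction i a t j            ≈⟨ //-rightDividesʳ _ _ ⟩
        Lc j                                                      ∎
      a≡a′ : Dec (d ≈ 0#) → a ≡ a′
      a≡a′ (yes d≈0) = enum-injective a a′ (sym (x∙y⁻¹≈ε⇒x≈y _ _ d≈0))
      a≡a′ (no d≉0) = ⊥-elim (proj₂ (u∉S i) (≋-resp (Span-isLinear (bS i))
        (λ j → trans (sym (*-assoc _ _ _)) (trans (*-congʳ (inverse-*ˡ d d≉0)) (*-identityˡ _)))
        (·-closed (Span-isLinear (bS i)) (inverse d d≉0) d·rᵢ∈S)))

    flat-injective : ∀ i a t i′ a′ t′ → flat i a t ≐ flat i′ a′ t′ → (i , a , t) ≡ (i′ , a′ , t′)
    flat-injective i a t i′ a′ t′ flat≐ with i Fin.≟ i′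
    ... | no i≢i′ = ⊥-elim (direction∉U i′ a′ t′ (sameDimension-⊆⇒⊇ (planeBasis i′ a′ t′) u
          (planeBasis-independent i′ a′ t′) u-independent U⊆plane′ _ (plane∋direction i′ a′ t′)))
      where
      U⊆plane′ : Span u ⊆ plane i′ a′ t′
      U⊆plane′ = distinct-S-span-U i i′ i≢i′ (plane-linear i′ a′ t′)
        (S⊆plane i a t ⊆-trans coset-direction (plane-linear i a t) (plane-linear i′ a′ t′) (proj₁ flat≐))
        (S⊆plane i′ a′ t′)
    ... | yes ≡.refl =
      let a≡a′ , t≡t′ = direction∈plane i a t a′ t′ d′∈plane in ≡.cong₂ (λ a t → i , a , t) a≡a′ t≡t′
      where
      d′∈plane : plane i a t (direction i a′ t′)
      d′∈plane = coset-direction (plane-linear i a′ t′) (plane-linear i a t) (proj₂ flat≐) _ (plane∋direction i a′ t′)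

    direction-∈ : ∀ i {P} → IsLinear P → S i ⊆ P → ∀ {v} → P v → ¬ Span u v →
                  ∃ λ a → ∃ λ t → P (direction i a t)
    direction-∈ i {P} P-linear Sᵢ⊆P {v} Pv v∉U = a , t , ≋-resp P-linear (λ j → sym (dir≈ j))
      (⊕-closed P-linear (·-closed P-linear μ Pv) (Sᵢ⊆P _ (proj₂ (S≐ i) _ (c ∘ suc , ≋-refl))))
      where
      normalized = lineRep-normalize e (π v) (v∉U ∘ π-kernel v)
      μ = proj₁ normalized
      t = proj₁ (proj₂ normalized)
      ℓ≈μπv : ∀ k → lineRep e t k ≈ μ * π v k
      ℓ≈μπv = proj₂ (proj₂ normalized)
      z = ((- μ) · v) ⊕ σ (lineRep e t)
      πz≈0 : ∀ k → π z k ≈ 0#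
      πz≈0 k = begin
        π z k                            ≈⟨ π-linear (- μ) v _ k ⟩
        - μ * π v k + π (σ (lineRep e t)) k  ≈⟨ +-cong (sym (-‿distribˡ-* μ (π v k))) (π-σ (lineRep e t) k) ⟩
        - (μ * π v k) + lineRep e t k    ≈⟨ +-congˡ (ℓ≈μπv k) ⟩
        - (μ * π v k) + μ * π v k        ≈⟨ -‿inverseˡ _ ⟩
        0#                               ∎
      z∈ = Span-u⊆ i z (π-kernel z πz≈0)
      c = proj₁ z∈
      a = proj₁ (enum-surjective (- c zero))
      dir≈ : ∀ j → direction i a t j ≈ μ * v j + lincomb (c ∘ suc) (bS i) j
      dir≈ j = trans (+-congʳ (*-congʳ (proj₂ (enum-surjective (- c zero)))))
        (eliminate-pivot (c zero) (r i j) (μ * v j) _ _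
          (trans (+-congʳ (-‿distribˡ-* μ (v j))) (proj₂ z∈ j)))

    cover : ∀ A → IsFlat 3 A → F3Family S s A → A ≐ (U′ +ₛ x) ⊎ ∃ λ i → ∃ λ a → ∃ λ t → A ≐ flat i a t
    cover A (P , y , (p , p-independent , P≐) , A≐) (_ , i , Sᵢ+sᵢ⊆A) = classify (Span-⊆-or-∉ u p)
      where
      P-linear : IsLinear P
      P-linear = IsLinear-resp-≐ P≐ (Span-isLinear p)
      A≐P+sᵢ : A ≐ (P +ₛ s i)
      A≐P+sᵢ = A≐ ≐-trans coset-shift P-linear (proj₁ A≐ _ (Sᵢ+sᵢ⊆A _ (coset-∋ (S-linear i) (s i))))
      Sᵢ⊆P : S i ⊆ P
      Sᵢ⊆P = coset-direction (S-linear i) P-linear (Sᵢ+sᵢ⊆A ⊆-trans proj₁ A≐P+sᵢ)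
      P≐plane : ∀ {a t} → P (direction i a t) → P ≐ plane i a t
      P≐plane {a} {t} P∋d = P≐ ≐-trans (sameDimension-⊆⇒⊇ p (planeBasis i a t) p-independent
        (planeBasis-independent i a t) plane⊆p , plane⊆p)
        where
        plane⊆p : plane i a t ⊆ Span p
        plane⊆p = Span-minimal P-linear (planeBasis i a t)
          (λ { zero → P∋d ; (suc m) → Sᵢ⊆P _ (proj₂ (S≐ i) _ (Span-∋ (bS i) m)) }) ⊆-trans proj₁ P≐
      classify : Span p ⊆ Span u ⊎ ∃ (λ k → ¬ Span u (p k)) →
                 A ≐ (U′ +ₛ x) ⊎ ∃ λ i → ∃ λ a → ∃ λ t → A ≐ flat i a t
      classify (inj₁ p⊆u) =
        inj₁ (A≐P+sᵢ ≐-trans +ₛ-cong (s i) P≐U′ ≐-trans ≐-sym (coset-shift U′-linear (s∈U i)))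
        where
        P≐U′ : P ≐ U′
        P≐U′ = P≐ ≐-trans (p⊆u , sameDimension-⊆⇒⊇ u p u-independent p-independent p⊆u) ≐-trans ≐-sym U′≐
      classify (inj₂ (k , pₖ∉U)) =
        let a , t , P∋d = direction-∈ i P-linear Sᵢ⊆P (proj₂ P≐ _ (Span-∋ p k)) pₖ∉U
        in inj₂ (i , a , t , A≐P+sᵢ ≐-trans +ₛ-cong (s i) (P≐plane P∋d))

    size : FlatFamilySize 3 (F3Family S s) (suc (Q ℕ.* (q ℕ.* g)))
    size = FlatFamilySize-↔ family (Fin.+↔⊎ ⟨↔⟩ (Fin.1↔⊤ ⊎-↔ (Fin.*↔× ⟨↔⟩ (↔-refl ×-↔ Fin.*↔×))))
      members injective (λ A A-flat A∈ → covered (cover A A-flat A∈))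
      where
      Index = ⊤ ⊎ (Fin Q × Fin q × Fin g)
      family : Index → PSet n
      family (inj₁ _)           = U′ +ₛ x
      family (inj₂ (i , a , t)) = flat i a t
      members : ∀ j → IsFlat 3 (family j) × F3Family S s (family j)
      members (inj₁ _)           = proj₁ U-F3 , U-F3
      members (inj₂ (i , a , t)) = proj₁ (flat-F3 i a t) , flat-F3 i a t
      injective : ∀ j j′ → family j ≐ family j′ → j ≡ j′
      injective (inj₁ _)           (inj₁ _)              _ = ≡.refl
      injective (inj₁ _)           (inj₂ (i , a , t))    U≐flat = ⊥-elim (flat≉U i a t (≐-sym U≐flat))
      injective (inj₂ (i , a , t)) (inj₁ _)              flat≐U = ⊥-elim (flat≉U i a t flat≐U)
      injective (inj₂ (i , a , t)) (inj₂ (i′ , a′ , t′)) flat≐ =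
        ≡.cong inj₂ (flat-injective i a t i′ a′ t′ flat≐)
      covered : ∀ {A} → A ≐ (U′ +ₛ x) ⊎ ∃ (λ i → ∃ λ a → ∃ λ t → A ≐ flat i a t) → ∃ λ j → A ≐ family j
      covered (inj₁ A≐U)               = inj₁ tt , A≐U
      covered (inj₂ (i , a , t , A≐)) = inj₂ (i , a , t) , A≐

gauss1-suc : ∀ q m → gauss1 q (suc m) ≡ suc (q ℕ.* gauss1 q m)
gauss1-suc q zero    = ≡.cong suc (≡.sym (ℕ.*-zeroʳ q))
gauss1-suc q (suc m) = begin
  q ℕ.^ suc m ℕ.+ gauss1 q (suc m)              ≡⟨ ≡.cong (q ℕ.^ suc m ℕ.+_) (gauss1-suc q m) ⟩
  q ℕ.* q ℕ.^ m ℕ.+ suc (q ℕ.* gauss1 q m)      ≡⟨ ℕ.+-suc _ _ ⟩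
  suc (q ℕ.* q ℕ.^ m ℕ.+ q ℕ.* gauss1 q m)      ≡⟨ ≡.cong suc (ℕ.*-distribˡ-+ q (q ℕ.^ m) (gauss1 q m)) ⟨
  suc (q ℕ.* gauss1 q (suc m))                  ∎
  where open ≡.≡-Reasoning

F3-count : ∀ q e n → e ℕ.+ 3 ≡ n → (q ℕ.^ 2 ℕ.+ q ℕ.+ 1) ℕ.* gauss1 q (n ℕ.∸ 2) ℕ.∸ q ℕ.^ 2 ℕ.∸ q
                                  ≡ suc ((q ℕ.^ 2 ℕ.+ q ℕ.+ 1) ℕ.* (q ℕ.* gauss1 q e))
F3-count q e _ ≡.refl = begin
  Q′ ℕ.* gauss1 q (e ℕ.+ 3 ℕ.∸ 2) ℕ.∸ q ℕ.^ 2 ℕ.∸ q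
    ≡⟨ ≡.cong (λ m → Q′ ℕ.* gauss1 q m ℕ.∸ q ℕ.^ 2 ℕ.∸ q) e+3∸2≡1+e ⟩
  Q′ ℕ.* gauss1 q (suc e) ℕ.∸ q ℕ.^ 2 ℕ.∸ q
    ≡⟨ ≡.cong (λ m → Q′ ℕ.* m ℕ.∸ q ℕ.^ 2 ℕ.∸ q) (gauss1-suc q e) ⟩
  Q′ ℕ.* suc X ℕ.∸ q ℕ.^ 2 ℕ.∸ q
    ≡⟨ ≡.cong (λ m → m ℕ.∸ q ℕ.^ 2 ℕ.∸ q) (ℕ.*-suc Q′ X) ⟩
  q ℕ.^ 2 ℕ.+ q ℕ.+ 1 ℕ.+ Q′ ℕ.* X ℕ.∸ q ℕ.^ 2 ℕ.∸ q
    ≡⟨ ≡.cong (λ m → m ℕ.∸ q ℕ.^ 2 ℕ.∸ q) (≡.trans (ℕ.+-assoc (q ℕ.^ 2 ℕ.+ q) 1 _) (ℕ.+-assoc (q ℕ.^ 2) q _)) ⟩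
  q ℕ.^ 2 ℕ.+ (q ℕ.+ suc (Q′ ℕ.* X)) ℕ.∸ q ℕ.^ 2 ℕ.∸ q
    ≡⟨ ≡.cong (ℕ._∸ q) (ℕ.m+n∸m≡n (q ℕ.^ 2) _) ⟩
  q ℕ.+ suc (Q′ ℕ.* X) ℕ.∸ q
    ≡⟨ ℕ.m+n∸m≡n q _ ⟩
  suc (Q′ ℕ.* X) ∎
  where
  open ≡.≡-Reasoning
  Q′ = q ℕ.^ 2 ℕ.+ q ℕ.+ 1
  X = q ℕ.* gauss1 q e
  e+3∸2≡1+e : e ℕ.+ 3 ℕ.∸ 2 ≡ suc e
  e+3∸2≡1+e = ≡.trans (ℕ.+-∸-assoc e {3} {2} (ℕ.s≤s (ℕ.s≤s ℕ.z≤n))) (ℕ.+-comm e 1)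

open import Data.Nat using (_+_; _*_; _^_; _∸_; _≤_)

lemma2p6 : (R : CommutativeRing 0ℓ 0ℓ) → Geometry.IsField R →
    (q : ℕ) → Geometry.HasCard R q →
    (n : ℕ) → 3 ≤ n →
    (U′ : Geometry.PSet R n) → Geometry.IsSubspace R 3 U′ →
    (x : Geometry.Point R n) →
    (S : Fin (q ^ 2 + q + 1) → Geometry.PSet R n) →
    (∀ i → Geometry.IsSubspace R 2 (S i)) →
    (∀ i → Geometry._⊆_ R (S i) U′) →
    (∀ i j → Geometry._≐_ R (S i) (S j) → i ≡ j) →
    (∀ P → Geometry.IsSubspace R 2 P → Geometry._⊆_ R P U′ →
      ∃ λ i → Geometry._≐_ R P (S i)) →
    (s : Fin (q ^ 2 + q + 1) → Geometry.Point R n) →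
    (∀ i → Geometry._+ₛ_ R U′ x (s i)) →
    Geometry.FlatFamilySize R 3 (Geometry.F3Family R S s)
      ((q ^ 2 + q + 1) * gauss1 q (n ∸ 2) ∸ q ^ 2 ∸ q)
lemma2p6 R isField q card n _ U′ U′-subspace x S S-subspace S⊆U′ S-injective _ s s∈U =
  ≡.subst (Geometry.FlatFamilySize R 3 (Geometry.F3Family R S s)) (≡.sym (F3-count q e n dimension)) size
  where open FiniteField.F3Count R isField q card n U′ U′-subspace x S S-subspace S⊆U′ S-injective s s∈U
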